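{- Let $r\ge2$, $\mu=(\mu_1,\dots,\mu_r)$ a tuple of positive integers, and $k_r\ge0$ an integer such that $k_r-\mu_r$ is odd and $k_r<\mu_r+2\sum_{i=1}^{r-1}\mu_i$. Put $\mu^T=(\mu_1,\dots,\mu_{r-1})$ and $k^\circ=\frac{k_r-(\mu_r+1)}{2}$. Then $$\Omega^{>}_B(\mu,k_r)=\bigsqcup_{\mathfrak s\in\Omega^{\le}_A(\mu^T,k^\circ)}\Omega^{>}_B(\mathfrak s,k_r),$$ i.e. the sets on the right are pairwise disjoint and their union is the left-hand side.
   Context: $\Omega^{>}_B(\mu,k_r)$ is the set of $(d_1,\dots,d_r)\in\mathbb Z_{\ge0}^r$ with $d_j\le\mu_j$ for $j\le r-1$, $d_r>\mu_r$, and $d_r+2\sum_{j=1}^{r-1}d_j=k_r$. For a tuple $\nu=(\nu_1,\dots,\nu_n)$ of positive integers, $\Omega^{\le}(\nu)=\{(x_1,\dots,x_n)\in\mathbb Z_{\ge0}^n:x_j\le\nu_j\}$, $k_A(x)=\sum x_j$, and $\Omega^{\le}_A(\nu,k)=\{x\in\Omega^{\le}(\nu):k_A(x)=k\}$. For non-maximal $\mathfrak s=(b_1,\dots,b_n)\in\Omega^{\le}(\nu)$ (i.e. $\mathfrak s\neq\nu$), $i_\Box(\mathfrak s)=\max\{i:b_i<\nu_i\}$ and $\Omega(\mathfrak s)$ is the set of $x\in\Omega^{\le}(\nu)$ with $x_i=b_i$ for $i<i_\Box(\mathfrak s)$ and $x_i\le b_i$ for $i\ge i_\Box(\mathfrak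 s)$; for $\mathfrak s=\nu$, $\Omega(\mathfrak s)=\Omega^{\le}(\nu)$. For $\mathfrak s\in\Omega^{\le}_A(\mu^T,k^\circ)$ (with $\nu=\mu^T$), $\Omega^{>}_B(\mathfrak s,k_r)=\{(\mathfrak s',d_r): \mathfrak s'\in\Omega(\mathfrak s),\ d_r=k_r-2k_A(\mathfrak s'),\ (\mathfrak s',d_r)\in\Omega^{>}_B(\mu,k_r)\}$. -}

module Defs where

open import Data.Nat using (ℕ; zero; suc; _+_; _*_; _≤_; _<_)
open import Data.Fin using (Fin; toℕ)
open import Data.Vec using (Vec; lookup; init; last; sum)
open import Data.Integer as ℤ using (ℤ; +_)
open import Data.Integer.DivMod using (_/_)
open import Data.Product using (_×_; ∃; Σ)
open import Data.Sum using (_⊎_)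
open import Relation.Binary.PropositionalEquality using (_≡_)
open import Relation.Nullary using (¬_)

-- Tuples of length n are Vec ℕ n; coordinate j (1-based in the paper) is lookup _ j.

Ωle : {n : ℕ} → Vec ℕ n → Vec ℕ n → Set
Ωle ν x = ∀ j → lookup x j ≤ lookup ν j

kA : {n : ℕ} → Vec ℕ n → ℕ
kA x = sum x

-- Ω^≤_A(ν,k), with k an integer (k may a priori be negative)
ΩleA : {n : ℕ} → Vec ℕ n → ℤ → Vec ℕ n → Set
ΩleA ν k x = Ωle ν x × (+ kA x ≡ k)

IsIBox : {n : ℕ} → Vec ℕ n → Vec ℕ n → Fin n → Set
IsIBox ν s i = (lookup s i < lookup ν i)
             × (∀ j → toℕ i Data.Nat.< toℕ j → ¬ (lookup s j < lookup ν j))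

Ωs : {n : ℕ} → Vec ℕ n → Vec ℕ n → Vec ℕ n → Set
Ωs ν s x =
  ((s ≡ ν) × Ωle ν x)
  ⊎ ((¬ (s ≡ ν)) × Ωle ν x ×
     ∃ λ i → IsIBox ν s i
           × (∀ j → toℕ j < toℕ i → lookup x j ≡ lookup s j)
           × (∀ j → toℕ i ≤ toℕ j → lookup x j ≤ lookup s j))

ΩgtB : {n : ℕ} → Vec ℕ (suc n) → ℕ → Vec ℕ (suc n) → Set
ΩgtB μ kr d =
  (∀ j → lookup (init d) j ≤ lookup (init μ) j)
  × (last μ < last d)
  × (last d + 2 * kA (init d) ≡ kr)

μT : {n : ℕ} → Vec ℕ (suc n) → Vec ℕ n
μT μ = init μ

kcirc : {n : ℕ} → Vec ℕ (suc n) → ℕ → ℤ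
kcirc μ kr = (+ kr ℤ.- (+ last μ ℤ.+ + 1)) / (+ 2)

-- Ω^>_B(s,k_r) = {(s',d_r) : s' ∈ Ω(s), d_r = k_r - 2 k_A(s'), (s',d_r) ∈ Ω^>_B(μ,k_r)}
-- (the element (s',d_r) is the vector d with init d = s', last d = d_r;
--  d_r = k_r - 2k_A(s') is stated as the integer-free equation d_r + 2 k_A(s') = k_r)
ΩgtBs : {n : ℕ} → Vec ℕ (suc n) → ℕ → Vec ℕ n → Vec ℕ (suc n) → Set
ΩgtBs μ kr s d =
  Ωs (μT μ) s (init d) × (last d + 2 * kA (init d) ≡ kr) × ΩgtB μ kr d

-- Write k_r = μ_r + 1 + 2m, so that k° = m.  For d ∈ Ω^>_B(μ,k_r) with x = (d_1,…,d_{r-1})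
-- we get 2 k_A(x) = k_r - d_r < k_r - μ_r, i.e. k_A(x) ≤ m, and m < k_A(μ^T) by the bound
-- on k_r.  Everything then reduces to a statement about type A: for x ∈ Ω^≤(ν) and
-- k_A(x) ≤ k < k_A(ν) there is exactly one s ∈ Ω^≤_A(ν,k) with x ∈ Ω(s).  Reading the
-- coordinates from the left, s copies x as long as the remaining budget exceeds what the
-- remaining coordinates of ν can absorb; at the first coordinate where it does not, s puts
-- all of the rest of the budget there and agrees with ν afterwards, and that coordinate
-- is i_□(s).
module Submission where

open import Defs
open import Data.Nat using (ℕ; suc; _+_; _*_; _≤_; _<_)
open import Data.Vec using (Vec; lookup; last)
open import Data.Integer as ℤ using (ℤ; +_)
open import Data.Product using (_×_; ∃)
open import Function.Bundles using (_⇔_)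
open import Relation.Binary.PropositionalEquality using (_≡_)

open import Data.Nat as ℕ using (z≤n; s≤s; _∸_; _≤?_)
open import Data.Nat.Properties
open import Data.Nat.DivMod using (m*n/n≡m)
open import Data.Fin as Fin using (toℕ)
open import Data.Vec using ([]; _∷_; init)
open import Data.Vec.Relation.Binary.Pointwise.Extensional using (ext; Pointwise-≡⇒≡)
open import Data.Product using (_,_)
open import Data.Sum using (inj₁; inj₂)
open import Data.Empty using (⊥-elim)
open import Relation.Nullary using (¬_; yes; no)
open import Relation.Binary.PropositionalEquality using (refl; sym; trans; cong; subst; module ≡-Reasoning)
open import Function.Bundles using (mk⇔)
open import Data.Integer.Properties as ℤ using (+-injective)
open import Data.Integer.DivMod using (div-pos-is-/ℕ)

private
  variable
    n : ℕ
    ν s t x : Vec ℕ n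

Ωle-tail : ∀ {a b} → Ωle (a ∷ ν) (b ∷ x) → Ωle ν x
Ωle-tail le j = le (Fin.suc j)

-- x ∈ Ω(s) for non-maximal s, by recursion on the first coordinate: either it is i_□(s),
-- after which s agrees with ν, or x and s agree there.
data InΩ : Vec ℕ n → Vec ℕ n → Vec ℕ n → Set where
  here  : ∀ {a b c} → c < a → b ≤ c → Ωle ν x → InΩ (a ∷ ν) (c ∷ ν) (b ∷ x)
  there : ∀ {a b} → InΩ ν s x → InΩ (a ∷ ν) (b ∷ s) (b ∷ x)

ΩNonMax : Vec ℕ n → Vec ℕ n → Vec ℕ n → Set
ΩNonMax ν s x = ∃ λ i → IsIBox ν s i
  × (∀ j → toℕ j < toℕ i → lookup x j ≡ lookup s j)
  × (∀ j → toℕ i ≤ toℕ j → lookup x j ≤ lookup s j)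

InΩ⇒kA< : Ωle ν s → InΩ ν s x → kA s < kA ν
InΩ⇒kA< {ν = a ∷ ν} _ (here c<a _ _) = +-monoˡ-< (kA ν) c<a
InΩ⇒kA< ls (there r) = +-mono-≤-< (ls Fin.zero) (InΩ⇒kA< (Ωle-tail ls) r)

InΩ⇒ΩNonMax : InΩ ν s x → ΩNonMax ν s x
InΩ⇒ΩNonMax {ν = a ∷ ν} {x = b ∷ x} (here {c = c} c<a b≤c lx) =
  Fin.zero , (c<a , tail-maximal) , (λ _ ()) , below
  where
  tail-maximal : ∀ j → 0 < toℕ j → ¬ (lookup (c ∷ ν) j < lookup (a ∷ ν) j)
  tail-maximal (Fin.suc j) _ = <-irrefl refl
  below : ∀ j → 0 ≤ toℕ j → lookup (b ∷ x) j ≤ lookup (c ∷ ν) j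
  below Fin.zero    _ = b≤c
  below (Fin.suc j) _ = lx j
InΩ⇒ΩNonMax (there r) with InΩ⇒ΩNonMax r
... | i , (si<νi , after) , agree , below =
  Fin.suc i , (si<νi , λ { (Fin.suc j) (s≤s i<j) → after j i<j }) ,
  (λ { Fin.zero _ → refl ; (Fin.suc j) (s≤s j<i) → agree j j<i }) ,
  (λ { (Fin.suc j) (s≤s i≤j) → below j i≤j })

ΩNonMax⇒InΩ : Ωle ν s → Ωle ν x → ΩNonMax ν s x → InΩ ν s x
ΩNonMax⇒InΩ {ν = a ∷ ν} {c ∷ s} {b ∷ x} ls lx (Fin.zero , (c<a , after) , _ , below)
  with Pointwise-≡⇒≡ {xs = s} {ν}
         (ext λ j → ≤-antisym (ls (Fin.suc j)) (≮⇒≥ (after (Fin.suc j) (s≤s z≤n))))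
... | refl = here c<a (below Fin.zero z≤n) (Ωle-tail lx)
ΩNonMax⇒InΩ {ν = _ ∷ _} {_ ∷ _} {_ ∷ _} ls lx (Fin.suc i , (sᵢ<νᵢ , after) , agree , below)
  with agree Fin.zero (s≤s z≤n)
... | refl = there (ΩNonMax⇒InΩ (Ωle-tail ls) (Ωle-tail lx)
  (i , (sᵢ<νᵢ , λ j i<j → after (Fin.suc j) (s≤s i<j)) ,
   (λ j j<i → agree (Fin.suc j) (s≤s j<i)) , λ j i≤j → below (Fin.suc j) (s≤s i≤j)))

n≤m<n+o⇒m∸n<o : ∀ {m n o} → n ≤ m → m < n + o → m ∸ n < o
n≤m<n+o⇒m∸n<o {m} {n} {o} n≤m m<n+o = subst (m ∸ n <_) (m+n∸m≡n n o) (∸-monoˡ-< m<n+o n≤m)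

InΩ-exists : ∀ k → Ωle ν x → kA x ≤ k → k < kA ν → ∃ λ s → Ωle ν s × kA s ≡ k × InΩ ν s x
InΩ-exists {ν = []} {[]} k _ _ ()
InΩ-exists {ν = a ∷ ν} {b ∷ x} k lx kAx≤k k<kAν with b + kA ν ≤? k
... | yes b+K≤k =
  (k ∸ kA ν ∷ ν) , ls , m∸n+n≡m K≤k , here s₀<a (m+n≤o⇒m≤o∸n b b+K≤k) (Ωle-tail lx)
  where
  K≤k : kA ν ≤ k
  K≤k = m+n≤o⇒n≤o b b+K≤k
  s₀<a : k ∸ kA ν < a
  s₀<a = n≤m<n+o⇒m∸n<o K≤k (subst (k <_) (+-comm a (kA ν)) k<kAν)
  ls : Ωle (a ∷ ν) (k ∸ kA ν ∷ ν)
  ls Fin.zero    = <⇒≤ s₀<a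
  ls (Fin.suc j) = ≤-refl
... | no b+K≰k
  with InΩ-exists (k ∸ b) (Ωle-tail lx) (m+n≤o⇒m≤o∸n (kA x) (subst (_≤ k) (+-comm b (kA x)) kAx≤k))
                  (n≤m<n+o⇒m∸n<o (m+n≤o⇒m≤o b kAx≤k) (≰⇒> b+K≰k))
... | s , ls , kAs≡k∸b , r =
  (b ∷ s) , (λ { Fin.zero → lx Fin.zero ; (Fin.suc j) → ls j }) ,
  trans (cong (λ e → b + e) kAs≡k∸b) (m+[n∸m]≡n (m+n≤o⇒m≤o b kAx≤k)) , there r

InΩ-unique : Ωle ν s → Ωle ν t → kA s ≡ kA t → InΩ ν s x → InΩ ν t x → s ≡ t
InΩ-unique {ν = _ ∷ ν} _ _ eq (here _ _ _) (here _ _ _) = cong (_∷ ν) (+-cancelʳ-≡ (kA ν) _ _ eq)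
InΩ-unique ls lt eq (there r) (there r′) =
  cong (_ ∷_) (InΩ-unique (Ωle-tail ls) (Ωle-tail lt) (+-cancelˡ-≡ _ _ _ eq) r r′)
InΩ-unique ls _ eq (there r) (here _ b≤c _) =
  ⊥-elim (<-irrefl eq (+-mono-≤-< b≤c (InΩ⇒kA< (Ωle-tail ls) r)))
InΩ-unique _ lt eq (here _ b≤c _) (there r) =
  ⊥-elim (<-irrefl (sym eq) (+-mono-≤-< b≤c (InΩ⇒kA< (Ωle-tail lt) r)))

InΩ⇒Ωs : Ωle ν s → Ωle ν x → InΩ ν s x → Ωs ν s x
InΩ⇒Ωs ls lx r = inj₂ ((λ s≡ν → <-irrefl (cong kA s≡ν) (InΩ⇒kA< ls r)) , lx , InΩ⇒ΩNonMax r)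

Ωs⇒InΩ : Ωle ν s → kA s < kA ν → Ωs ν s x → InΩ ν s x
Ωs⇒InΩ _  kAs<kAν (inj₁ (refl , _))    = ⊥-elim (<-irrefl refl kAs<kAν)
Ωs⇒InΩ ls _       (inj₂ (_ , lx , nm)) = ΩNonMax⇒InΩ ls lx nm

Ωs-cover : ∀ (ν x : Vec ℕ n) {k} → Ωle ν x → kA x ≤ k → k < kA ν →
           ∃ λ s → Ωle ν s × kA s ≡ k × Ωs ν s x
Ωs-cover ν x {k} lx kAx≤k k<kAν with InΩ-exists {x = x} k lx kAx≤k k<kAν
... | s , ls , kAs≡k , r = s , ls , kAs≡k , InΩ⇒Ωs ls lx r

Ωs-disjoint : ∀ (ν s t x : Vec ℕ n) {k} → Ωle ν s → Ωle ν t → kA s ≡ k → kA t ≡ k → k < kA ν →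
              Ωs ν s x → Ωs ν t x → s ≡ t
Ωs-disjoint ν s t x ls lt refl kAt≡k k<kAν xs xt =
  InΩ-unique {x = x} ls lt (sym kAt≡k)
    (Ωs⇒InΩ ls k<kAν xs) (Ωs⇒InΩ lt (subst (_< _) (sym kAt≡k) k<kAν) xt)

1+2*-[1+m]≡-[1+2m] : ∀ m → + 1 ℤ.+ + 2 ℤ.* ℤ.-[1+ m ] ≡ ℤ.-[1+ 2 * m ]
1+2*-[1+m]≡-[1+2m] m rewrite +-suc m (m + 0) = refl

odd-excess : ∀ L kr t → L < kr → + kr ℤ.- + L ≡ + 1 ℤ.+ + 2 ℤ.* t → ∃ λ m → kr ≡ L + suc (2 * m)
odd-excess L kr t L<kr parity = excess t (trans (sym difference) parity)
  where
  difference : + kr ℤ.- + L ≡ + (kr ∸ L)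
  difference = trans (ℤ.[+m]-[+n]≡m⊖n kr L) (ℤ.⊖-≥ (<⇒≤ L<kr))
  excess : ∀ t → + (kr ∸ L) ≡ + 1 ℤ.+ + 2 ℤ.* t → ∃ λ m → kr ≡ L + suc (2 * m)
  excess (+ m) eq = m , trans (sym (m+[n∸m]≡n (<⇒≤ L<kr)))
    (cong (λ e → L + e) (+-injective (trans eq (cong (ℤ._+_ (+ 1)) (sym (ℤ.pos-* 2 m))))))
  excess ℤ.-[1+ m ] eq with trans eq (1+2*-[1+m]≡-[1+2m] m)
  ... | ()

kcirc-odd : (μ : Vec ℕ (suc n)) (m : ℕ) → kcirc μ (last μ + suc (2 * m)) ≡ + m
kcirc-odd μ m = begin
  kcirc μ (L + suc (2 * m))               ≡⟨ cong (ℤ._/ + 2) (ℤ.[+m]-[+n]≡m⊖n (L + suc (2 * m)) (L + 1)) ⟩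
  ((L + suc (2 * m)) ℤ.⊖ (L + 1)) ℤ./ + 2 ≡⟨ cong (ℤ._/ + 2) (ℤ.+-cancelˡ-⊖ L (suc (2 * m)) 1) ⟩
  + (2 * m) ℤ./ + 2                       ≡⟨ div-pos-is-/ℕ (+ (2 * m)) 2 ⟩
  + (2 * m ℕ./ 2)                         ≡⟨ cong (λ e → + (e ℕ./ 2)) (*-comm 2 m) ⟩
  + (m * 2 ℕ./ 2)                         ≡⟨ cong +_ (m*n/n≡m m 2) ⟩
  + m                                     ∎
  where
  open ≡-Reasoning
  L = last μ

ΩgtB⇒kcirc : ∀ {μ : Vec ℕ (suc n)} {kr d} → ΩgtB μ kr d →
  (∃ λ t → + kr ℤ.- + last μ ≡ + 1 ℤ.+ + 2 ℤ.* t) → kr < last μ + 2 * kA (μT μ) →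
  ∃ λ m → kcirc μ kr ≡ + m × kA (init d) ≤ m × m < kA (μT μ)
ΩgtB⇒kcirc {μ = μ} {kr} {d} (_ , μr<dr , eq) (t , parity) bound
  with odd-excess (last μ) kr t (<-≤-trans μr<dr (subst (last d ≤_) eq (m≤m+n _ _))) parity
... | m , refl = m , kcirc-odd μ m , kAx≤m , m<K
  where
  L = last μ
  kAx≤m : kA (init d) ≤ m
  kAx≤m = *-cancelˡ-≤ 2 (+-cancelˡ-≤ (suc L) _ _ (begin
    suc L + 2 * kA (init d)   ≤⟨ +-monoˡ-≤ _ μr<dr ⟩
    last d + 2 * kA (init d)  ≡⟨ eq ⟩
    L + suc (2 * m)           ≡⟨ +-suc L (2 * m) ⟩
    suc L + 2 * m             ∎))
    where open ≤-Reasoning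
  m<K : m < kA (μT μ)
  m<K = *-cancelˡ-< 2 m (kA (μT μ)) (<⇒≤ (+-cancelˡ-< L _ _ bound))

lemma5 : (n : ℕ) → 1 ≤ n → (μ : Vec ℕ (suc n)) → (∀ j → 0 < lookup μ j) →
    (kr : ℕ) → (∃ λ t → + kr ℤ.- + last μ ≡ + 1 ℤ.+ + 2 ℤ.* t) →
    kr < last μ + 2 * kA (μT μ) →
    ((d : Vec ℕ (suc n)) →
       ΩgtB μ kr d ⇔ (∃ λ s → ΩleA (μT μ) (kcirc μ kr) s × ΩgtBs μ kr s d))
    × ((s t : Vec ℕ n) (d : Vec ℕ (suc n)) →
       ΩleA (μT μ) (kcirc μ kr) s → ΩleA (μT μ) (kcirc μ kr) t →
       ΩgtBs μ kr s d → ΩgtBs μ kr t d → s ≡ t)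
lemma5 n _ μ _ kr parity bound = (λ d → mk⇔ (cover d) λ (_ , _ , _ , _ , g) → g) , disjoint
  where
  cover : ∀ d → ΩgtB μ kr d → ∃ λ s → ΩleA (μT μ) (kcirc μ kr) s × ΩgtBs μ kr s d
  cover d g@(lx , _ , eq) with ΩgtB⇒kcirc g parity bound
  ... | m , k°≡m , kAx≤m , m<K with Ωs-cover (μT μ) (init d) lx kAx≤m m<K
  ... | s , ls , kAs≡m , xs = s , (ls , trans (cong +_ kAs≡m) (sym k°≡m)) , xs , eq , g
  disjoint : (s t : Vec ℕ n) (d : Vec ℕ (suc n)) →
    ΩleA (μT μ) (kcirc μ kr) s → ΩleA (μT μ) (kcirc μ kr) t →
    ΩgtBs μ kr s d → ΩgtBs μ kr t d → s ≡ t
  disjoint s t d (ls , ks) (lt , kt) (xs , _ , g) (xt , _ , _) with ΩgtB⇒kcirc g parity bound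
  ... | m , k°≡m , _ , m<K = Ωs-disjoint (μT μ) s t (init d) ls lt (kA≡m s ks) (kA≡m t kt) m<K xs xt
    where
    kA≡m : ∀ u → + kA u ≡ kcirc μ kr → kA u ≡ m
    kA≡m _ e = +-injective (trans e k°≡m)
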